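{- Let $G$ be a graph with at least one vertex, $k\ge1$, and $(T,\delta)$ a rooted branch decomposition of $G$ with root $\mathfrak{r}$ (so $V_{\mathfrak{r}}=V(G)$ and $\sim_{\mathfrak{r}}$ has the single class $V(G)$). Let $\rho=(f,1)$ be the $\mathfrak{r}$-type with $f(V(G))=\mathrm{contains}$, and let $\gamma$ be the $\mathfrak{r}$-signature with $\gamma(\rho)=k$ and $\gamma(\tau)=0$ for all other $\mathfrak{r}$-types $\tau$. Then $G$ has a $b$-coloring with $k$ colors if and only if there exists a valid partial $b$-coloring of $G$ (with $k$ colors) whose $\mathfrak{r}$-signature is $\gamma$.
   Context: Graphs are finite and simple. A proper coloring $(C_1,\ldots,C_k)$ (ordered partition of the vertex set into independent, possibly empty, sets) is a $b$-coloring if each $C_i$ contains a vertex with a neighbor in every $C_j$, $j\ne i$. A rooted branch decomposition of $G$ is a pair $(T,\delta)$ with $T$ a rooted tree of maximum degree at most $3$ and $\delta$ a bijection from $V(G)$ to the leaves of $T$. For a node $t$: $V_t$ is the set of vertices mapped to leaves of the subtree rooted at $t$, $\overline{V_t}=V(G)\setminus V_t$, $G_t=G[V_t]$, and $\sim_t$ is the equivalence relation on $V_t$ with $u\sim_t v$ iff $N_G(u)\cap\overline{V_t}=N_G(v)\cap\overline{V_t}$. A partial $b$-coloring of $G_t$ is a pair $(\mathcal{C},B)$ with $\mathcal{C}=(C_1,\ldots,C_k)$ a proper coloring of $G_t$ and $B\subseteq V_t$ with $|C_i\cap B|\le1$ for all $i$. The $t$-type of a class $C=C_i$ is $(f,\beta)$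 with $\beta=1$ iff $C\cap B\ne\emptyset$ (else $0$), and $f:V_t/{\sim_t}\to\{\mathrm{none},\mathrm{contains},\mathrm{demand}\}$: $f(Q)=\mathrm{contains}$ if $Q\cap C\ne\emptyset$; $f(Q)=\mathrm{demand}$ if $Q\cap C=\emptyset$ and some $v\in B\cap Q$ has $N_{G_t}(v)\cap C=\emptyset$; $\mathrm{none}$ otherwise. A class $C$ is invalid if some $Q\in V_t/{\sim_t}$ with $Q\cap C\ne\emptyset$ contains a $v\in B$ with $N_{G_t}[v]\cap C=\emptyset$; the partial $b$-coloring is valid if all classes are valid. A $t$-signature is a map from the set of $t$-types to $\{0,1,\ldots,k\}$ with values summing to $k$; the $t$-signature of a partial $b$-coloring maps each $t$-type to the number of its colour classes of that type. -}

module Defs where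

open import Data.Nat using (ℕ; zero; suc; _+_)
open import Data.Fin using (Fin; zero; suc)
open import Data.Fin.Properties using () renaming (_≟_ to _≟F_)
open import Data.Bool using (Bool; true; false; _∧_; _∨_; not; if_then_else_)
open import Data.List using (List; []; _∷_; _++_; allFin)
open import Data.List.Relation.Binary.Permutation.Propositional using (_↭_)
open import Data.Product using (Σ; ∃; _×_; _,_; proj₁; proj₂)
open import Data.Sum using (_⊎_)
open import Relation.Binary.PropositionalEquality using (_≡_)
open import Relation.Nullary using (¬_; does)

record Graph : Set where
  field
    n      : ℕ
    adj    : Fin n → Fin n → Bool
    sym    : ∀ u v → adj u v ≡ adj v u
    irrefl : ∀ v → adj v v ≡ false
open Graph public

anyF : ∀ {m} → (Fin m → Bool) → Bool
anyF {zero}  p = false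
anyF {suc m} p = p zero ∨ anyF (λ i → p (suc i))

allF : ∀ {m} → (Fin m → Bool) → Bool
allF {zero}  p = true
allF {suc m} p = p zero ∧ allF (λ i → p (suc i))

countF : ∀ {m} → (Fin m → Bool) → ℕ
countF {zero}  p = 0
countF {suc m} p = (if p zero then 1 else 0) + countF (λ i → p (suc i))

_==F_ : ∀ {m} → Fin m → Fin m → Bool
i ==F j = does (i ≟F j)

_==B_ : Bool → Bool → Bool
true  ==B b = b
false ==B b = not b

-- Rooted branch decompositions.
-- A non-root node has at most 2 children (degree ≤ 3 counting its parent);
-- the root may have up to 3 children.  Leaves carry vertices.

data SubTree (n : ℕ) : Set where
  leaf  : Fin n → SubTree n
  node1 : SubTree n → SubTree n
  node2 : SubTree n → SubTree n → SubTree n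

data RootTree (n : ℕ) : Set where
  sub   : SubTree n → RootTree n
  node3 : SubTree n → SubTree n → SubTree n → RootTree n

leavesS : ∀ {n} → SubTree n → List (Fin n)
leavesS (leaf v)    = v ∷ []
leavesS (node1 t)   = leavesS t
leavesS (node2 t s) = leavesS t ++ leavesS s

leavesR : ∀ {n} → RootTree n → List (Fin n)
leavesR (sub t)       = leavesS t
leavesR (node3 t s r) = leavesS t ++ leavesS s ++ leavesS r

memB : ∀ {n} → Fin n → List (Fin n) → Bool
memB v []       = false
memB v (u ∷ us) = (u ==F v) ∨ memB v us

-- (T, δ): δ is a bijection V(G) → leaves, i.e. the leaf labels are a
-- permutation of all vertices.
record RootedBranchDecomposition (G : Graph) : Set where
  field
    tree      : RootTree (n G)
    bijective : leavesR tree ↭ allFin (n G)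
open RootedBranchDecomposition public

V-root : ∀ {G} → RootedBranchDecomposition G → Fin (n G) → Bool
V-root T v = memB v (leavesR (tree T))

data Status : Set where
  none contains demand : Status

_==S_ : Status → Status → Bool
none     ==S none     = true
contains ==S contains = true
demand   ==S demand   = true
_        ==S _        = false

-- Notions relative to a node t, given through its vertex set V_t : Fin n → Bool.
-- A colouring with k colours is c : Fin n → Fin k; C_i = {v ∈ V_t | c v = i}
-- (values of c outside V_t are irrelevant).

module _ (G : Graph) (Vt : Fin (n G) → Bool) where

  simB : Fin (n G) → Fin (n G) → Bool
  simB u v = allF (λ w → Vt w ∨ (adj G u w ==B adj G v w))

  record IsPartialBColoring (k : ℕ) (c : Fin (n G) → Fin k)
                            (B : Fin (n G) → Bool) : Set where
    field
      proper  : ∀ u v → Vt u ≡ true → Vt v ≡ true → adj G u v ≡ true → ¬ (c u ≡ c v)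
      B⊆Vt    : ∀ v → B v ≡ true → Vt v ≡ true
      B-atmost1 : ∀ u v → B u ≡ true → B v ≡ true → c u ≡ c v → u ≡ v

  Valid : ∀ {k} → (Fin (n G) → Fin k) → (Fin (n G) → Bool) → Set
  Valid {k} c B =
    ∀ (i : Fin k) (v : Fin (n G)) → Vt v ≡ true → B v ≡ true →
      (∃ λ u → Vt u ≡ true × simB u v ≡ true × c u ≡ i) →
      ∃ λ w → Vt w ≡ true × (w ≡ v ⊎ adj G v w ≡ true) × c w ≡ i

  -- A t-type (f , β); f : V_t/∼_t → Status is represented as a function on
  -- vertices that is constant on ∼_t-classes of V_t (values outside V_t ignored).
  TType : Set
  TType = Σ (Fin (n G) → Status) (λ f →
            ∀ u v → Vt u ≡ true → Vt v ≡ true → simB u v ≡ true → f u ≡ f v) × Bool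

  eqType : TType → TType → Bool
  eqType ((f , _) , β) ((g , _) , β') =
    allF (λ v → not (Vt v) ∨ (f v ==S g v)) ∧ (β ==B β')

  typeF : ∀ {k} → (Fin (n G) → Fin k) → (Fin (n G) → Bool) → Fin k → Fin (n G) → Status
  typeF c B i v =
    if anyF (λ u → Vt u ∧ simB u v ∧ (c u ==F i)) then contains
    else if anyF (λ u → Vt u ∧ B u ∧ simB u v ∧
                    not (anyF (λ w → Vt w ∧ adj G u w ∧ (c w ==F i))))
         then demand else none

  typeβ : ∀ {k} → (Fin (n G) → Fin k) → (Fin (n G) → Bool) → Fin k → Bool
  typeβ c B i = anyF (λ u → Vt u ∧ B u ∧ (c u ==F i))

  HasSignature : ∀ {k} → (Fin (n G) → Fin k) → (Fin (n G) → Bool) → (TType → ℕ) → Set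
  HasSignature c B σ =
    ∀ (τ : TType) →
      countF (λ i → allF (λ v → not (Vt v) ∨ (typeF c B i v ==S proj₁ (proj₁ τ) v))
                    ∧ (typeβ c B i ==B proj₂ τ))
        ≡ σ τ

record IsBColoring (G : Graph) (k : ℕ) (c : Fin (n G) → Fin k) : Set where
  field
    proper    : ∀ u v → adj G u v ≡ true → ¬ (c u ≡ c v)
    dominating : ∀ (i : Fin k) → ∃ λ v → c v ≡ i ×
                   (∀ (j : Fin k) → ¬ (j ≡ i) → ∃ λ u → adj G v u ≡ true × c u ≡ j)

HasBColoring : Graph → ℕ → Set
HasBColoring G k = ∃ λ (c : Fin (n G) → Fin k) → IsBColoring G k c

module _ {G : Graph} (T : RootedBranchDecomposition G) where

  ρ-root : TType G (V-root T)
  ρ-root = ((λ _ → contains) , (λ _ _ _ _ _ → _≡_.refl)) , true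

  γ-root : ℕ → TType G (V-root T) → ℕ
  γ-root k τ = if eqType G (V-root T) τ ρ-root then k else 0

module Submission where

-- At the root 𝔯 of a branch decomposition every vertex lies in V_𝔯 and all
-- vertices are ∼_𝔯-equivalent, so the type of a colour class C_i collapses to
-- two bits: whether C_i is non-empty (f = contains everywhere) and whether C_i
-- meets B (β).  Hence the 𝔯-type ρ is exactly the type of a class meeting B,
-- and the signature γ (k classes of type ρ, none of any other type) says
-- precisely that every colour class meets B.  Validity at the root says that a
-- vertex of B sees every non-empty colour in its closed neighbourhood.
-- So a valid partial b-colouring with signature γ is the same thing as a
-- proper colouring together with one b-vertex (the B-vertex) in every class,
-- which is a b-colouring; conversely a b-colouring gives such a B by choosing
-- one dominating vertex per class.

open import Defs hiding (sym)
open import Data.Nat using (ℕ; _≤_; _+_; zero; suc; z≤n; s≤s)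
open import Data.Nat.Properties using (suc-injective; m≤n⇒m≤1+n; 1+n≰n)
open import Data.Fin using (Fin; zero; suc)
open import Data.Fin.Properties using () renaming (_≟_ to _≟F_)
open import Data.Bool using (Bool; true; false; _∧_; _∨_; not; if_then_else_)
open import Data.Bool.Properties using (∧-conicalˡ; ∧-conicalʳ)
open import Data.Product using (∃; ∃-syntax; _×_; _,_; proj₁; proj₂)
open import Data.Sum using (inj₁; inj₂)
open import Data.List using (List; _∷_)
open import Data.List.Relation.Unary.Any using (here; there)
open import Data.List.Membership.Propositional using (_∈_)
open import Data.List.Membership.Propositional.Properties using (∈-allFin)
open import Data.List.Relation.Binary.Permutation.Propositional using (↭-sym)
open import Data.List.Relation.Binary.Permutation.Propositional.Properties using (∈-resp-↭)
open import Relation.Binary.PropositionalEquality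
  using (_≡_; _≢_; refl; sym; trans; cong; subst; module ≡-Reasoning)
open import Relation.Nullary using (yes; no; contradiction)
open import Relation.Nullary.Decidable using (dec-true)
open import Function.Bundles using (_⇔_; mk⇔)

==F-complete : ∀ {m} {a b : Fin m} → a ≡ b → (a ==F b) ≡ true
==F-complete {a = a} {b} = dec-true (a ≟F b)

==F-sound : ∀ {m} (a b : Fin m) → (a ==F b) ≡ true → a ≡ b
==F-sound a b e with a ≟F b
... | yes a≡b = a≡b

==B-true : ∀ b → (b ==B true) ≡ b
==B-true true  = refl
==B-true false = refl

contains-==S : ∀ s → (contains ==S s) ≡ (s ==S contains)
contains-==S none     = refl
contains-==S contains = refl
contains-==S demand   = refl

anyF-intro : ∀ {m} (p : Fin m → Bool) (i : Fin m) → p i ≡ true → anyF p ≡ true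
anyF-intro p zero    pi rewrite pi = refl
anyF-intro p (suc i) pi with p zero
... | true  = refl
... | false = anyF-intro (λ j → p (suc j)) i pi

anyF-elim : ∀ {m} (p : Fin m → Bool) → anyF p ≡ true → ∃ λ i → p i ≡ true
anyF-elim {suc m} p e with p zero in p0
... | true  = zero , p0
... | false with anyF-elim (λ j → p (suc j)) e
...   | i , pi = suc i , pi

allF-intro : ∀ {m} (p : Fin m → Bool) → (∀ i → p i ≡ true) → allF p ≡ true
allF-intro {zero}  p all = refl
allF-intro {suc m} p all rewrite all zero = allF-intro (λ j → p (suc j)) (λ j → all (suc j))

allF-cong : ∀ {m} (p q : Fin m → Bool) → (∀ i → p i ≡ q i) → allF p ≡ allF q
allF-cong {zero}  p q p≗q = refl
allF-cong {suc m} p q p≗q rewrite p≗q zero =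
  cong (q zero ∧_) (allF-cong _ _ (λ j → p≗q (suc j)))

countF-cong : ∀ {m} (p q : Fin m → Bool) → (∀ i → p i ≡ q i) → countF p ≡ countF q
countF-cong {zero}  p q p≗q = refl
countF-cong {suc m} p q p≗q rewrite p≗q zero =
  cong (_ +_) (countF-cong _ _ (λ j → p≗q (suc j)))

countF-const : ∀ {m} (b : Bool) → countF {m} (λ _ → b) ≡ (if b then m else 0)
countF-const {zero}  true  = refl
countF-const {zero}  false = refl
countF-const {suc m} true  = cong suc (countF-const {m} true)
countF-const {suc m} false = countF-const {m} false

countF-≤ : ∀ {m} (p : Fin m → Bool) → countF p ≤ m
countF-≤ {zero}  p = z≤n
countF-≤ {suc m} p with p zero
... | true  = s≤s (countF-≤ (λ j → p (suc j)))
... | false = m≤n⇒m≤1+n (countF-≤ (λ j → p (suc j)))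

countF-full : ∀ {m} (p : Fin m → Bool) → countF p ≡ m → ∀ i → p i ≡ true
countF-full {suc m} p e i with p zero in p0
countF-full {suc m} p e zero    | true  = p0
countF-full {suc m} p e (suc i) | true  = countF-full (λ j → p (suc j)) (suc-injective e) i
countF-full {suc m} p e i       | false =
  contradiction (subst (_≤ m) e (countF-≤ (λ j → p (suc j)))) 1+n≰n

memB-complete : ∀ {m} (v : Fin m) (xs : List (Fin m)) → v ∈ xs → memB v xs ≡ true
memB-complete v (u ∷ us) (here refl) rewrite ==F-complete {a = u} refl = refl
memB-complete v (u ∷ us) (there v∈us) rewrite memB-complete v us v∈us with u ==F v
... | true  = refl
... | false = refl

ClassesMeet : ∀ {G : Graph} {k} → (Fin (n G) → Fin k) → (Fin (n G) → Bool) → Set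
ClassesMeet {k = k} c B = ∀ (i : Fin k) → ∃ λ u → B u ≡ true × c u ≡ i

module Root {G : Graph} (T : RootedBranchDecomposition G) where

  V𝔯 : Fin (n G) → Bool
  V𝔯 = V-root T

  -- Since δ is a bijection onto the leaves, V_𝔯 = V(G).
  inRoot : ∀ v → V𝔯 v ≡ true
  inRoot v = memB-complete v (leavesR (tree T)) (∈-resp-↭ (↭-sym (bijective T)) (∈-allFin v))

  restrict-root : ∀ v b → (not (V𝔯 v) ∨ b) ≡ b
  restrict-root v b rewrite inRoot v = refl

  -- ∼_𝔯 relates all vertices: there are no vertices outside V_𝔯.
  sim-root : ∀ u v → simB G V𝔯 u v ≡ true
  sim-root u v = allF-intro _ (λ w → cong (_∨ _) (inRoot w))

  root-filter : ∀ u v b → (V𝔯 u ∧ simB G V𝔯 u v ∧ b) ≡ b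
  root-filter u v b rewrite inRoot u | sim-root u v = refl

  ρ-self : eqType G V𝔯 (ρ-root T) (ρ-root T) ≡ true
  ρ-self rewrite allF-intro (λ v → not (V𝔯 v) ∨ true) (λ v → restrict-root v true) = refl

  module _ {k : ℕ} (c : Fin (n G) → Fin k) (B : Fin (n G) → Bool) where

    classHasType : TType G V𝔯 → Fin k → Bool
    classHasType ((f , _) , β) i =
      allF (λ v → not (V𝔯 v) ∨ (typeF G V𝔯 c B i v ==S f v)) ∧ (typeβ G V𝔯 c B i ==B β)

    typeF-nonempty : ∀ i u → c u ≡ i → ∀ v → typeF G V𝔯 c B i v ≡ contains
    typeF-nonempty i u cu≡i v
      rewrite anyF-intro (λ w → V𝔯 w ∧ simB G V𝔯 w v ∧ (c w ==F i)) u
                (trans (root-filter u v (c u ==F i)) (==F-complete cu≡i)) = refl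

    typeβ-intro : ∀ i u → B u ≡ true → c u ≡ i → typeβ G V𝔯 c B i ≡ true
    typeβ-intro i u Bu cu≡i = anyF-intro _ u witness
      where
      witness : (V𝔯 u ∧ B u ∧ (c u ==F i)) ≡ true
      witness rewrite inRoot u | Bu = ==F-complete cu≡i

    typeβ-elim : ∀ i → typeβ G V𝔯 c B i ≡ true → ∃ λ u → B u ≡ true × c u ≡ i
    typeβ-elim i e with anyF-elim _ e
    ... | u , hit = u , ∧-conicalˡ (B u) _ (∧-conicalʳ (V𝔯 u) _ hit)
                      , ==F-sound (c u) i (∧-conicalʳ (B u) _ (∧-conicalʳ (V𝔯 u) _ hit))

    classHasType-ρ : ClassesMeet {G} c B → ∀ τ i → classHasType τ i ≡ eqType G V𝔯 τ (ρ-root T)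
    classHasType-ρ meet τ@((f , _) , β) i with meet i
    ... | u , Bu , cu≡i = begin
      classHasType τ i
        ≡⟨ cong (_ ∧_) (cong (_==B β) (typeβ-intro i u Bu cu≡i)) ⟩
      allF (λ v → not (V𝔯 v) ∨ (typeF G V𝔯 c B i v ==S f v)) ∧ β
        ≡⟨ cong (_∧ β) (allF-cong _ _ statusAt) ⟩
      allF (λ v → not (V𝔯 v) ∨ (f v ==S contains)) ∧ β
        ≡⟨ cong (_ ∧_) (sym (==B-true β)) ⟩
      eqType G V𝔯 τ (ρ-root T) ∎
      where
      open ≡-Reasoning
      statusAt : ∀ v → (not (V𝔯 v) ∨ (typeF G V𝔯 c B i v ==S f v))
                     ≡ (not (V𝔯 v) ∨ (f v ==S contains))
      statusAt v rewrite typeF-nonempty i u cu≡i v = cong (_ ∨_) (contains-==S (f v))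

    signature-intro : ClassesMeet {G} c B → HasSignature G V𝔯 c B (γ-root T k)
    signature-intro meet τ = begin
      countF (classHasType τ)                     ≡⟨ countF-cong _ _ (classHasType-ρ meet τ) ⟩
      countF {k} (λ _ → eqType G V𝔯 τ (ρ-root T)) ≡⟨ countF-const (eqType G V𝔯 τ (ρ-root T)) ⟩
      γ-root T k τ                                ∎
      where open ≡-Reasoning

    signature-elim : HasSignature G V𝔯 c B (γ-root T k) → ClassesMeet {G} c B
    signature-elim sig i = typeβ-elim i
      (trans (sym (==B-true _)) (∧-conicalʳ _ _ (countF-full _ kClassesOfTypeρ i)))
      where
      kClassesOfTypeρ : countF (classHasType (ρ-root T)) ≡ k
      kClassesOfTypeρ = trans (sig (ρ-root T)) (cong (λ b → if b then k else 0) ρ-self)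

    valid-sees : Valid G V𝔯 c B → ∀ {v u} j → B v ≡ true → c u ≡ j → j ≢ c v →
                 ∃ λ w → adj G v w ≡ true × c w ≡ j
    valid-sees valid {v} {u} j Bv cu≡j j≢cv
      with valid j v (inRoot v) Bv (u , inRoot u , sim-root u v , cu≡j)
    ... | w , _ , inj₁ refl , cv≡j = contradiction (sym cv≡j) j≢cv
    ... | w , _ , inj₂ vw   , cw≡j = w , vw , cw≡j

  -- A b-colouring yields the valid partial b-colouring whose B consists of one
  -- chosen dominating vertex per class.
  bColoring⇒partial : ∀ {k} (c : Fin (n G) → Fin k) → IsBColoring G k c →
    ∃[ B ] (IsPartialBColoring G V𝔯 k c B × Valid G V𝔯 c B × ClassesMeet {G} c B)
  bColoring⇒partial {k} c bc = B , partial , valid , meet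
    where
    open IsBColoring bc
    dom : Fin k → Fin (n G)
    dom i = proj₁ (dominating i)
    dom-colour : ∀ i → c (dom i) ≡ i
    dom-colour i = proj₁ (proj₂ (dominating i))
    dom-sees : ∀ i j → j ≢ i → ∃ λ u → adj G (dom i) u ≡ true × c u ≡ j
    dom-sees i = proj₂ (proj₂ (dominating i))
    B : Fin (n G) → Bool
    B v = v ==F dom (c v)
    isDom : ∀ v → B v ≡ true → v ≡ dom (c v)
    isDom v = ==F-sound v (dom (c v))
    meet : ClassesMeet {G} c B
    meet i = dom i , ==F-complete (cong dom (sym (dom-colour i))) , dom-colour i
    partial : IsPartialBColoring G V𝔯 k c B
    partial = record
      { proper    = λ u v _ _ uv → proper u v uv
      ; B⊆Vt      = λ v _ → inRoot v
      ; B-atmost1 = λ u v Bu Bv cu≡cv → trans (isDom u Bu) (trans (cong dom cu≡cv) (sym (isDom v Bv)))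
      }
    valid : Valid G V𝔯 c B
    valid i v _ Bv _ with c v ≟F i
    ... | yes cv≡i = v , inRoot v , inj₁ refl , cv≡i
    ... | no cv≢i with dom-sees (c v) i (λ i≡cv → cv≢i (sym i≡cv))
    ...   | w , dw , cw≡i =
      w , inRoot w , inj₂ (subst (λ x → adj G x w ≡ true) (sym (isDom v Bv)) dw) , cw≡i

  partial⇒bColoring : ∀ {k} (c : Fin (n G) → Fin k) (B : Fin (n G) → Bool) →
    IsPartialBColoring G V𝔯 k c B → Valid G V𝔯 c B → ClassesMeet {G} c B →
    IsBColoring G k c
  partial⇒bColoring c B partial valid meet = record
    { proper     = λ u v uv → IsPartialBColoring.proper partial u v (inRoot u) (inRoot v) uv
    ; dominating = bVertex
    }
    where
    bVertex : ∀ i → ∃ λ v → c v ≡ i × (∀ j → j ≢ i → ∃ λ u → adj G v u ≡ true × c u ≡ j)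
    bVertex i with meet i
    ... | v , Bv , refl = v , refl , λ j j≢cv →
      let u , _ , cu≡j = meet j in valid-sees c B valid j Bv cu≡j j≢cv

mainTheorem9 : (G : Graph) → 1 ≤ n G → (k : ℕ) → 1 ≤ k →
    (T : RootedBranchDecomposition G) →
    HasBColoring G k ⇔
      (∃[ c ] ∃[ B ] (IsPartialBColoring G (V-root T) k c B
                       × Valid G (V-root T) c B
                       × HasSignature G (V-root T) c B (γ-root T k)))
mainTheorem9 G _ k _ T = mk⇔ toPartial toBColoring
  where
  open Root T
  toPartial : HasBColoring G k →
    ∃[ c ] ∃[ B ] (IsPartialBColoring G V𝔯 k c B × Valid G V𝔯 c B × HasSignature G V𝔯 c B (γ-root T k))
  toPartial (c , bc) with bColoring⇒partial c bc
  ... | B , partial , valid , meet = c , B , partial , valid , signature-intro c B meet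
  toBColoring : ∃[ c ] ∃[ B ] (IsPartialBColoring G V𝔯 k c B × Valid G V𝔯 c B × HasSignature G V𝔯 c B (γ-root T k)) →
    HasBColoring G k
  toBColoring (c , B , partial , valid , sig) =
    c , partial⇒bColoring c B partial valid (signature-elim c B sig)
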